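{- Suppose $v\in S_n$ avoids $2143$ and $w_0 v$ is not contained in any maximal parabolic subgroup $S_j\times S_{n-j}$ ($1\le j\le n-1$) of $S_n$. Order the bounding boxes of $\Gamma_{[v,w_0]}$ by the row of their northwest corner. If $\Gamma_{[v,w_0]}$ has more than one bounding box, then the bounding boxes alternate between blue and red, and no bounding box is purple.
   Context: $S_n$ is the symmetric group in one-line notation ($v_i=v(i)$), $w_0$ the longest element, $(w_0v)(i)=n+1-v_i$. $S_j\times S_{n-j}$ denotes the permutations mapping $[j]$ to itself. $\Gamma_{[v,w_0]} := \{(i,u_i): u\geq v \text{ in Bruhat order}, i\in[n]\}\subseteq[n]^2$, with $(i,j)$ = row $i$, column $j$, rows numbered top to bottom. For $i\in[n]$, $\overline{B}_{i,v_i}$ is the square region of $[n]^2$ with corners $(i,v_i)$, $(i,n-i+1)$, $(n-v_i+1,v_i)$, $(n-v_i+1,n-i+1)$ (a square centred on the antidiagonal with a corner at $(i,v_i)$). It is a bounding box of $\Gamma_{[v,w_0]}$ if there is no $j$ with $\overline{B}_{i,v_i}\subsetneq\overline{B}_{j,v_j}$; then $(i,v_i)$ is called a spanning corner. A bounding box $\overline{B}_{i,v_i}$ (with $(i,v_i)$ a spanning corner) is red if $(i,v_i)$ lies below the antidiagonal ($i+v_i>n+1$), green if on it ($i+v_i=n+1$), blue if above it ($i+v_i<n+1$). If both $\overline{B}_{i,v_i}$ and $\overline{B}_{n-v_i+1,n-i+1}$ are bounding boxes (so the same box arises from a red and a blue spanning corner), the box is both red and blue, and is called purple. -}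

module Defs where

open import Data.Nat using (ℕ; suc; _+_; _∸_; _≤_; _<_; _⊓_; _⊔_)
open import Data.Fin using (Fin; toℕ)
open import Data.Fin.Permutation using (Permutation′; _⟨$⟩ʳ_)
open import Data.Product using (Σ; _×_; ∃; ∃-syntax)
open import Relation.Nullary using (¬_)
open import Relation.Binary.PropositionalEquality using (_≡_)

-- Conventions: positions and values are 1-indexed as in the paper.
-- A point (i , v i) of the paper corresponds to  pos i  and  val v i
-- for i : Fin n.

pos : {n : ℕ} → Fin n → ℕ
pos i = suc (toℕ i)

val : {n : ℕ} → Permutation′ n → Fin n → ℕ
val v i = suc (toℕ (v ⟨$⟩ʳ i))

w0v : {n : ℕ} → Permutation′ n → Fin n → ℕ
w0v {n} v i = suc n ∸ val v i

Contains2143 : {n : ℕ} → Permutation′ n → Set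
Contains2143 {n} v = Σ (Fin n) λ a → Σ (Fin n) λ b → Σ (Fin n) λ c → Σ (Fin n) λ d →
  (pos a < pos b) × (pos b < pos c) × (pos c < pos d) ×
  (val v b < val v a) × (val v a < val v d) × (val v d < val v c)

Avoids2143 : {n : ℕ} → Permutation′ n → Set
Avoids2143 v = ¬ Contains2143 v

-- u ∈ S_j × S_{n-j}: u maps [j] to itself.  Here u = w₀ v.
W0vInParabolic : {n : ℕ} → Permutation′ n → ℕ → Set
W0vInParabolic {n} v j = ∀ (i : Fin n) → pos i ≤ j → w0v v i ≤ j

W0vNotInMaxParabolic : {n : ℕ} → Permutation′ n → Set
W0vNotInMaxParabolic {n} v = ∀ (j : ℕ) → 1 ≤ j → j ≤ n ∸ 1 → ¬ W0vInParabolic v j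

-- Membership of (r , c) ∈ [n]² in the square  B̄_{i,v_i}  with corners
-- (i,v_i), (i,n-i+1), (n-v_i+1,v_i), (n-v_i+1,n-i+1).
InBox : {n : ℕ} → Permutation′ n → Fin n → Fin n → Fin n → Set
InBox {n} v i r c =
  ((pos i ⊓ (suc n ∸ val v i)) ≤ pos r) × (pos r ≤ (pos i ⊔ (suc n ∸ val v i))) ×
  ((val v i ⊓ (suc n ∸ pos i)) ≤ pos c) × (pos c ≤ (val v i ⊔ (suc n ∸ pos i)))

BoxSub : {n : ℕ} → Permutation′ n → Fin n → Fin n → Set
BoxSub {n} v i j = ∀ (r c : Fin n) → InBox v i r c → InBox v j r c

BoxStrictSub : {n : ℕ} → Permutation′ n → Fin n → Fin n → Set
BoxStrictSub v i j = BoxSub v i j × ¬ BoxSub v j i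

SameBox : {n : ℕ} → Permutation′ n → Fin n → Fin n → Set
SameBox v i j = BoxSub v i j × BoxSub v j i

-- (i , v_i) is a spanning corner, i.e. B̄_{i,v_i} is a bounding box of Γ_[v,w₀]
SpanningCorner : {n : ℕ} → Permutation′ n → Fin n → Set
SpanningCorner {n} v i = ¬ (Σ (Fin n) λ j → BoxStrictSub v i j)

Red : {n : ℕ} → Permutation′ n → Fin n → Set
Red {n} v i = suc n < pos i + val v i

Green : {n : ℕ} → Permutation′ n → Fin n → Set
Green {n} v i = pos i + val v i ≡ suc n

Blue : {n : ℕ} → Permutation′ n → Fin n → Set
Blue {n} v i = pos i + val v i < suc n

PurpleBoxExists : {n : ℕ} → Permutation′ n → Set
PurpleBoxExists {n} v = Σ (Fin n) λ i → Σ (Fin n) λ j →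
  SpanningCorner v i × SpanningCorner v j × SameBox v i j × Red v i × Blue v j

MoreThanOneBox : {n : ℕ} → Permutation′ n → Set
MoreThanOneBox {n} v = Σ (Fin n) λ i → Σ (Fin n) λ j →
  SpanningCorner v i × SpanningCorner v j × ¬ SameBox v i j

nwRow : {n : ℕ} → Permutation′ n → Fin n → ℕ
nwRow {n} v i = pos i ⊓ (suc n ∸ val v i)

Consecutive : {n : ℕ} → Permutation′ n → Fin n → Fin n → Set
Consecutive {n} v i j =
  SpanningCorner v i × SpanningCorner v j × (nwRow v i < nwRow v j) ×
  ¬ (Σ (Fin n) λ k → SpanningCorner v k × (nwRow v i < nwRow v k) × (nwRow v k < nwRow v j))

module Submission where

-- Record the corner of row i as the point (p i , w i) with
-- p i = i and w i = n + 1 - v_i = (w₀v)(i).  The box B̄_{i,v_i} occupies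
-- the rows [lo i , hi i] with lo = min (p , w) and hi = max (p , w); its
-- columns are determined by its rows, so inclusion of boxes is inclusion
-- of row intervals, and a corner is red, green or blue as w < p, w = p or
-- p < w.  In these coordinates the hypotheses read:
--   * v avoids 2143  iff  the point set (p , w) contains no 3412 pattern;
--   * w₀v lies in no maximal parabolic  iff  every cut J ∈ [1 , n-1] is
--     crossed upwards (p k ≤ J < w k) by some point; since w is a
--     bijection, a counting argument shows it is then also crossed
--     downwards (w k ≤ J < p k), i.e. upwards in the transposed diagram.

open import Defs
open import Data.Nat using (ℕ)
open import Data.Fin using (Fin)
open import Data.Fin.Permutation using (Permutation′)
open import Data.Product using (_×_)
open import Data.Sum using (_⊎_)
open import Relation.Nullary using (¬_)

open import Data.Nat using (suc; _+_; _∸_; _≤_; _<_; _⊓_; _⊔_; z≤n; s≤s; s≤s⁻¹)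
open import Data.Nat.Properties
open import Data.Fin using (toℕ; opposite; inject≤; lower)
import Data.Fin as Fin
open import Data.Fin.Properties
  using (toℕ-injective; toℕ<n; toℕ-inject≤; opposite-prop; opposite-involutive; any?; injective⇒≤; lower-injective)
open import Data.Fin.Permutation using (_⟨$⟩ʳ_; _⟨$⟩ˡ_; inverseˡ; inverseʳ)
open import Data.Product using (Σ; _,_; proj₁; proj₂; map₂)
open import Data.Sum using (inj₁; inj₂)
open import Data.Empty using (⊥; ⊥-elim)
open import Function using (_∘_)
open import Relation.Nullary using (Dec; yes; no; ¬?)
open import Relation.Nullary.Decidable using (_×-dec_; decidable-stable)
open import Relation.Binary using (tri<; tri≈; tri>)
open import Relation.Binary.PropositionalEquality
  using (_≡_; _≢_; refl; sym; trans; cong; subst; subst₂; module ≡-Reasoning)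

injection-below : ∀ {m n J} (f : Fin m → Fin n) → (∀ {a b} → f a ≡ f b → a ≡ b) →
                  (∀ a → toℕ (f a) < J) → m ≤ J
injection-below f f-injective below =
  injective⇒≤ {f = λ a → lower (f a) (below a)} (f-injective ∘ lower-injective _ _)

<⇒≤∸1 : ∀ {J n} → J < n → J ≤ n ∸ 1
<⇒≤∸1 (s≤s J≤n) = J≤n

record Diagram (n : ℕ) : Set where
  field
    x y         : Fin n → ℕ
    x-injective : ∀ {a b} → x a ≡ x b → a ≡ b
    y-injective : ∀ {a b} → y a ≡ y b → a ≡ b
    x≥1         : ∀ a → 1 ≤ x a
    y≥1         : ∀ a → 1 ≤ y a
    x≤n         : ∀ a → x a ≤ n
    y≤n         : ∀ a → y a ≤ n

transpose : ∀ {n} → Diagram n → Diagram n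
transpose D = record
  { x = y ; y = x ; x-injective = y-injective ; y-injective = x-injective
  ; x≥1 = y≥1 ; y≥1 = x≥1 ; x≤n = y≤n ; y≤n = x≤n }
  where open Diagram D

module _ {n : ℕ} (D : Diagram n) where
  open Diagram D

  Pattern3412 : Set
  Pattern3412 = Σ (Fin n) λ a → Σ (Fin n) λ b → Σ (Fin n) λ c → Σ (Fin n) λ d →
    (x a < x b) × (x b < x c) × (x c < x d) × (y c < y d) × (y d < y a) × (y a < y b)

  AllCutsCrossed : Set
  AllCutsCrossed = ∀ J → 1 ≤ J → J < n → Σ (Fin n) λ k → x k ≤ J × J < y k

  crossing-below : AllCutsCrossed → ∀ c → 2 ≤ c → c ≤ n → Σ (Fin n) λ k → x k < c × c ≤ y k
  crossing-below cross (suc J) (s≤s 1≤J) J<n with cross J 1≤J J<n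
  ... | k , xk≤J , J<yk = k , s≤s xk≤J , J<yk

  -- Points with different coordinates in one direction are distinct, so
  -- they also differ in the other direction: this sharpens ≤ to <.
  x-strict : ∀ {a b} → x a ≤ x b → y a ≢ y b → x a < x b
  x-strict le ne = ≤∧≢⇒< le (ne ∘ cong y ∘ x-injective)

  y-strict : ∀ {a b} → y a ≤ y b → x a ≢ x b → y a < y b
  y-strict le ne = ≤∧≢⇒< le (ne ∘ cong x ∘ y-injective)

  -- Two red points i , j (y < x) in "staircase" position, such that no
  -- point left of y j rises above x i, force a 3412 pattern: crossings of
  -- the cuts just below y j and at x i supply the two missing points.
  red-staircase-3412 : AllCutsCrossed → ∀ i j → y i < x i → y j < x j →
    y i < y j → x i < x j → (∀ k → x k < y j → y k ≤ x i) → Pattern3412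
  red-staircase-3412 cross i j red-i red-j yi<yj xi<xj floor
    with crossing-below cross (y j) (≤-<-trans (y≥1 i) yi<yj) (y≤n j)
       | cross (x i) (x≥1 i) (<-≤-trans xi<xj (x≤n j))
  ... | q , xq<yj , yj≤yq | k , xk≤xi , xi<yk =
    q , k , i , j , xq<xk , xk<xi , xi<xj , yi<yj , yj<yq , yq<yk
    where
    yq≤xi : y q ≤ x i
    yq≤xi = floor q xq<yj
    yj<yq : y j < y q
    yj<yq = y-strict yj≤yq (>⇒≢ (<-trans xq<yj red-j))
    yj≤xk : y j ≤ x k
    yj≤xk = ≮⇒≥ λ xk<yj → <⇒≱ xi<yk (floor k xk<yj)
    xq<xk : x q < x k
    xq<xk = <-≤-trans xq<yj yj≤xk
    xk<xi : x k < x i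
    xk<xi = x-strict xk≤xi (>⇒≢ (<-trans red-i xi<yk))
    yq<yk : y q < y k
    yq<yk = ≤-<-trans yq≤xi xi<yk

transpose-3412 : ∀ {n} (D : Diagram n) → Pattern3412 (transpose D) → Pattern3412 D
transpose-3412 D (a , b , c , d , t₁ , t₂ , t₃ , t₄ , t₅ , t₆) = c , d , a , b , t₄ , t₅ , t₆ , t₁ , t₂ , t₃

-- A box [L , H] with a red corner i = (H , L) and a blue corner
-- j = (L , H) which no point straddles (starts below L and ends above H):
-- if it is not the whole square [1 , n], the crossings of a cut at its
-- top or just below its bottom produce a 3412 pattern.
module PurpleBox {n : ℕ} (D : Diagram n) (up : AllCutsCrossed D) (down : AllCutsCrossed (transpose D))
                 (i j : Fin n) (xj≡yi : Diagram.x D j ≡ Diagram.y D i) (yj≡xi : Diagram.y D j ≡ Diagram.x D i)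
                 (red-i : Diagram.y D i < Diagram.x D i)
                 (straddle-x : ∀ k → Diagram.x D k < Diagram.y D i → Diagram.y D k ≤ Diagram.x D i)
                 (straddle-y : ∀ k → Diagram.y D k < Diagram.y D i → Diagram.x D k ≤ Diagram.x D i) where
  open Diagram D

  top-3412 : x i < n → Pattern3412 D
  top-3412 H<n with up (x i) (x≥1 i) H<n | down (x i) (x≥1 i) H<n
  ... | k , xk≤H , H<yk | m , ym≤H , H<xm =
    j , k , i , m , xj<xk , xk<xi , H<xm , yi<ym , ym<yj , yj<yk
    where
    xj<xk : x j < x k
    xj<xk = x-strict D (subst (_≤ x k) (sym xj≡yi) (≮⇒≥ λ xk<L → <⇒≱ H<yk (straddle-x k xk<L)))
                     (<⇒≢ (subst (_< y k) (sym yj≡xi) H<yk))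
    xk<xi : x k < x i
    xk<xi = x-strict D xk≤H (>⇒≢ (<-trans red-i H<yk))
    yi<ym : y i < y m
    yi<ym = y-strict D (≮⇒≥ λ ym<L → <⇒≱ H<xm (straddle-y m ym<L)) (<⇒≢ H<xm)
    ym<yj : y m < y j
    ym<yj = y-strict D (subst (y m ≤_) (sym yj≡xi) ym≤H)
                     (>⇒≢ (subst (_< x m) (sym xj≡yi) (<-trans red-i H<xm)))
    yj<yk : y j < y k
    yj<yk = subst (_< y k) (sym yj≡xi) H<yk

  bottom-3412 : 2 ≤ y i → Pattern3412 D
  bottom-3412 2≤L with crossing-below D up (y i) 2≤L (y≤n i)
                     | crossing-below (transpose D) down (y i) 2≤L (y≤n i)
  ... | k , xk<L , L≤yk | m , ym<L , L≤xm =
    k , j , m , i , xk<xj , xj<xm , xm<xi , ym<yi , yi<yk , yk<yj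
    where
    xk<xj : x k < x j
    xk<xj = subst (x k <_) (sym xj≡yi) xk<L
    xj<xm : x j < x m
    xj<xm = x-strict D (subst (_≤ x m) (sym xj≡yi) L≤xm)
                     (>⇒≢ (subst (y m <_) (sym yj≡xi) (<-trans ym<L red-i)))
    xm<xi : x m < x i
    xm<xi = x-strict D (straddle-y m ym<L) (<⇒≢ ym<L)
    ym<yi : y m < y i
    ym<yi = ym<L
    yi<yk : y i < y k
    yi<yk = y-strict D L≤yk (>⇒≢ (<-trans xk<L red-i))
    yk<yj : y k < y j
    yk<yj = y-strict D (subst (y k ≤_) (sym yj≡xi) (straddle-x k xk<L)) (<⇒≢ xk<xj)

module Corners {n : ℕ} (v : Permutation′ n) where

  σ : Fin n → Fin n
  σ i = v ⟨$⟩ʳ i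

  w : Fin n → ℕ
  w = w0v v

  w≡pos∘opposite : ∀ i → w i ≡ pos (opposite (σ i))
  w≡pos∘opposite i = begin
    n ∸ toℕ (σ i)                    ≡⟨ +-∸-assoc 1 (toℕ<n (σ i)) ⟩
    suc (n ∸ suc (toℕ (σ i)))        ≡⟨ cong suc (opposite-prop (σ i)) ⟨
    pos (opposite (σ i))             ∎
    where open ≡-Reasoning

  atAntiColumn : Fin n → Fin n
  atAntiColumn t = v ⟨$⟩ˡ opposite t

  w-atAntiColumn : ∀ t → w (atAntiColumn t) ≡ pos t
  w-atAntiColumn t = begin
    w (atAntiColumn t)                  ≡⟨ w≡pos∘opposite (atAntiColumn t) ⟩
    pos (opposite (σ (atAntiColumn t))) ≡⟨ cong (pos ∘ opposite) (inverseʳ v) ⟩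
    pos (opposite (opposite t))         ≡⟨ cong pos (opposite-involutive t) ⟩
    pos t                               ∎
    where open ≡-Reasoning

  pos-injective : ∀ {a b : Fin n} → pos a ≡ pos b → a ≡ b
  pos-injective = toℕ-injective ∘ suc-injective

  w-injective : ∀ {a b} → w a ≡ w b → a ≡ b
  w-injective {a} {b} eq = begin
    a                      ≡⟨ inverseˡ v ⟨
    v ⟨$⟩ˡ σ a              ≡⟨ cong (v ⟨$⟩ˡ_) σa≡σb ⟩
    v ⟨$⟩ˡ σ b              ≡⟨ inverseˡ v ⟩
    b                      ∎
    where
    open ≡-Reasoning
    opposite-injective : ∀ {s t : Fin n} → opposite s ≡ opposite t → s ≡ t
    opposite-injective {s} {t} e =
      trans (sym (opposite-involutive s)) (trans (cong opposite e) (opposite-involutive t))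
    σa≡σb : σ a ≡ σ b
    σa≡σb = opposite-injective (pos-injective
      (trans (sym (w≡pos∘opposite a)) (trans eq (w≡pos∘opposite b))))

  w≥1 : ∀ i → 1 ≤ w i
  w≥1 i = subst (1 ≤_) (sym (w≡pos∘opposite i)) (s≤s z≤n)

  w≤n : ∀ i → w i ≤ n
  w≤n i = subst (_≤ n) (sym (w≡pos∘opposite i)) (toℕ<n (opposite (σ i)))

  D : Diagram n
  D = record
    { x = pos ; y = w ; x-injective = pos-injective ; y-injective = w-injective
    ; x≥1 = λ _ → s≤s z≤n ; y≥1 = w≥1 ; x≤n = toℕ<n ; y≤n = w≤n }

  w+val≡N : ∀ i → w i + val v i ≡ suc n
  w+val≡N i = begin
    (n ∸ toℕ (σ i)) + suc (toℕ (σ i)) ≡⟨ +-suc (n ∸ toℕ (σ i)) (toℕ (σ i)) ⟩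
    suc ((n ∸ toℕ (σ i)) + toℕ (σ i)) ≡⟨ cong suc (m∸n+n≡m (<⇒≤ (toℕ<n (σ i)))) ⟩
    suc n                             ∎
    where open ≡-Reasoning

  val≡N∸w : ∀ i → val v i ≡ suc n ∸ w i
  val≡N∸w i = trans (sym (m+n∸m≡n (w i) (val v i))) (cong (_∸ w i) (w+val≡N i))

  val-reverses : ∀ {a b} → w a < w b → val v b < val v a
  val-reverses {a} {b} wa<wb = +-cancelˡ-< (w a) (val v b) (val v a) (begin-strict
    w a + val v b <⟨ +-monoˡ-< (val v b) wa<wb ⟩
    w b + val v b ≡⟨ w+val≡N b ⟩
    suc n         ≡⟨ w+val≡N a ⟨
    w a + val v a ∎)
    where open ≤-Reasoning

  3412⇒2143 : Pattern3412 D → Contains2143 v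
  3412⇒2143 (a , b , c , d , pa<pb , pb<pc , pc<pd , wc<wd , wd<wa , wa<wb) =
    a , b , c , d , pa<pb , pb<pc , pc<pd , val-reverses wa<wb , val-reverses wd<wa , val-reverses wc<wd

  red⇒w<p : ∀ {i} → Red v i → w i < pos i
  red⇒w<p {i} red = +-cancelʳ-< (val v i) (w i) (pos i) (subst (_< pos i + val v i) (sym (w+val≡N i)) red)

  w<p⇒red : ∀ {i} → w i < pos i → Red v i
  w<p⇒red {i} lt = subst (_< pos i + val v i) (w+val≡N i) (+-monoˡ-< (val v i) lt)

  blue⇒p<w : ∀ {i} → Blue v i → pos i < w i
  blue⇒p<w {i} blue = +-cancelʳ-< (val v i) (pos i) (w i) (subst (pos i + val v i <_) (sym (w+val≡N i)) blue)

  p<w⇒blue : ∀ {i} → pos i < w i → Blue v i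
  p<w⇒blue {i} lt = subst (pos i + val v i <_) (w+val≡N i) (+-monoˡ-< (val v i) lt)

  -- The rows [lo i , hi i] of the box B̄_{i,v_i}; lo i is nwRow v i.
  lo hi : Fin n → ℕ
  lo i = pos i ⊓ w i
  hi i = pos i ⊔ w i

  lo≤p : ∀ i → lo i ≤ pos i
  lo≤p i = m⊓n≤m (pos i) (w i)
  lo≤w : ∀ i → lo i ≤ w i
  lo≤w i = m⊓n≤n (pos i) (w i)
  p≤hi : ∀ i → pos i ≤ hi i
  p≤hi i = m≤m⊔n (pos i) (w i)
  w≤hi : ∀ i → w i ≤ hi i
  w≤hi i = m≤n⊔m (pos i) (w i)
  lo≥1 : ∀ i → 1 ≤ lo i
  lo≥1 i = ⊓-glb (s≤s z≤n) (w≥1 i)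
  hi≤n : ∀ i → hi i ≤ n
  hi≤n i = ⊔-lub (toℕ<n i) (w≤n i)

  lo-below : ∀ {i} → pos i ≤ w i → lo i ≡ pos i
  lo-below = m≤n⇒m⊓n≡m
  hi-below : ∀ {i} → pos i ≤ w i → hi i ≡ w i
  hi-below = m≤n⇒m⊔n≡n
  lo-above : ∀ {i} → w i ≤ pos i → lo i ≡ w i
  lo-above = m≥n⇒m⊓n≡n
  hi-above : ∀ {i} → w i ≤ pos i → hi i ≡ pos i
  hi-above = m≥n⇒m⊔n≡m

  green-lo : ∀ {i} → pos i ≡ w i → lo i ≡ pos i
  green-lo p≡w = lo-below (≤-reflexive p≡w)
  green-hi : ∀ {i} → pos i ≡ w i → hi i ≡ pos i
  green-hi p≡w = trans (hi-below (≤-reflexive p≡w)) (sym p≡w)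

  Sub : Fin n → Fin n → Set
  Sub i j = (lo j ≤ lo i) × (hi i ≤ hi j)

  Sub? : ∀ i j → Dec (Sub i j)
  Sub? i j = (lo j ≤? lo i) ×-dec (hi i ≤? hi j)

  Sub-trans : ∀ {i j k} → Sub i j → Sub j k → Sub i k
  Sub-trans (lj≤li , hi≤hj) (lk≤lj , hj≤hk) = ≤-trans lk≤lj lj≤li , ≤-trans hi≤hj hj≤hk

  column-lo : ∀ i → val v i ⊓ (suc n ∸ pos i) ≡ suc n ∸ hi i
  column-lo i = begin
    val v i ⊓ (suc n ∸ pos i)           ≡⟨ cong (_⊓ (suc n ∸ pos i)) (val≡N∸w i) ⟩
    (suc n ∸ w i) ⊓ (suc n ∸ pos i)     ≡⟨ ∸-distribˡ-⊔-⊓ (suc n) (w i) (pos i) ⟨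
    suc n ∸ (w i ⊔ pos i)               ≡⟨ cong (suc n ∸_) (⊔-comm (w i) (pos i)) ⟩
    suc n ∸ hi i                        ∎
    where open ≡-Reasoning

  column-hi : ∀ i → val v i ⊔ (suc n ∸ pos i) ≡ suc n ∸ lo i
  column-hi i = begin
    val v i ⊔ (suc n ∸ pos i)           ≡⟨ cong (_⊔ (suc n ∸ pos i)) (val≡N∸w i) ⟩
    (suc n ∸ w i) ⊔ (suc n ∸ pos i)     ≡⟨ ∸-distribˡ-⊓-⊔ (suc n) (w i) (pos i) ⟨
    suc n ∸ (w i ⊓ pos i)               ≡⟨ cong (suc n ∸_) (⊓-comm (w i) (pos i)) ⟩
    suc n ∸ lo i                        ∎
    where open ≡-Reasoning

  -- Box inclusion is inclusion of row intervals: the box of i contains its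
  -- corner (i , v_i) and the mirror point (opposite (σ i) , v_i) in row w i,
  -- and its columns are a function of its rows.
  box⇒sub : ∀ {i j} → BoxSub v i j → Sub i j
  box⇒sub {i} {j} i⊆j = ⊓-glb (proj₁ corner) (proj₁ mirror) , ⊔-lub (proj₂ corner) (proj₂ mirror)
    where
    columns : (val v i ⊓ (suc n ∸ pos i) ≤ val v i) × (val v i ≤ val v i ⊔ (suc n ∸ pos i))
    columns = m⊓n≤m (val v i) (suc n ∸ pos i) , m≤m⊔n (val v i) (suc n ∸ pos i)
    corner : (lo j ≤ pos i) × (pos i ≤ hi j)
    corner with i⊆j i (σ i) (lo≤p i , p≤hi i , columns)
    ... | a , b , _ = a , b
    mirror : (lo j ≤ w i) × (w i ≤ hi j)
    mirror with i⊆j (opposite (σ i)) (σ i)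
                  (subst (lo i ≤_) (w≡pos∘opposite i) (lo≤w i) ,
                   subst (_≤ hi i) (w≡pos∘opposite i) (w≤hi i) , columns)
    ... | a , b , _ = subst (lo j ≤_) (sym (w≡pos∘opposite i)) a ,
                      subst (_≤ hi j) (sym (w≡pos∘opposite i)) b

  sub⇒box : ∀ {i j} → Sub i j → BoxSub v i j
  sub⇒box {i} {j} (lj≤li , hi≤hj) r c (lo≤r , r≤hi , col-lo , col-hi) =
    ≤-trans lj≤li lo≤r , ≤-trans r≤hi hi≤hj ,
    subst (_≤ pos c) (sym (column-lo j))
      (≤-trans (∸-monoʳ-≤ (suc n) hi≤hj) (subst (_≤ pos c) (column-lo i) col-lo)) ,
    subst (pos c ≤_) (sym (column-hi j))
      (≤-trans (subst (pos c ≤_) (column-hi i) col-hi) (∸-monoʳ-≤ (suc n) lj≤li))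

  maximal : ∀ {i k} → SpanningCorner v i → Sub i k → Sub k i
  maximal {i} {k} span i⊆k =
    decidable-stable (Sub? k i) λ k⊈i → span (k , sub⇒box i⊆k , k⊈i ∘ box⇒sub)

  spanning-intro : ∀ {i} → (∀ j → Sub i j → Sub j i) → SpanningCorner v i
  spanning-intro max (j , i⊆j , j⊈i) = j⊈i (sub⇒box (max j (box⇒sub i⊆j)))

  maximal-hi : ∀ {i k} → SpanningCorner v i → lo k ≤ lo i → hi k ≤ hi i
  maximal-hi {i} {k} span lk≤li with ≤-total (hi k) (hi i)
  ... | inj₁ hk≤hi = hk≤hi
  ... | inj₂ hi≤hk = proj₂ (maximal span (lk≤li , hi≤hk))

  -- Every box lies in a bounding box: each strict enlargement decreases
  -- the slack lo k + (N ∸ hi k), so repeated enlargement terminates.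
  slack : Fin n → ℕ
  slack k = lo k + (suc n ∸ hi k)

  slack-decreases : ∀ {k j} → Sub k j → ¬ Sub j k → slack j < slack k
  slack-decreases {k} {j} (lj≤lk , hk≤hj) j⊈k with lo k ≤? lo j
  ... | yes lk≤lj = +-mono-≤-< lj≤lk
        (∸-monoʳ-< (≰⇒> (j⊈k ∘ (lk≤lj ,_))) (≤-trans (hi≤n j) (n≤1+n n)))
  ... | no lk≰lj = +-mono-<-≤ (≰⇒> lk≰lj) (∸-monoʳ-≤ (suc n) hk≤hj)

  bounding-above : ∀ k → Σ (Fin n) λ m → SpanningCorner v m × Sub k m
  bounding-above k = search (suc (slack k)) k ≤-refl
    where
    search : ∀ fuel k → slack k < fuel → Σ (Fin n) λ m → SpanningCorner v m × Sub k m
    search (suc fuel) k slack<fuel with any? (λ j → Sub? k j ×-dec ¬? (Sub? j k))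
    ... | yes (j , k⊆j , j⊈k) =
      map₂ (map₂ (Sub-trans k⊆j)) (search fuel j (<-≤-trans (slack-decreases k⊆j j⊈k) (s≤s⁻¹ slack<fuel)))
    ... | no none = k , spanning-intro (λ j k⊆j → decidable-stable (Sub? j k) (λ j⊈k → none (j , k⊆j , j⊈k)))
                      , (≤-refl , ≤-refl)

  -- With at most one point, all boxes coincide.
  more⇒2≤n : MoreThanOneBox v → 2 ≤ n
  more⇒2≤n (a , b , _ , _ , a≠b) = ≮⇒≥ λ n<2 → a≠b (subst (SameBox v a) (unique n<2 a b) same)
    where
    same : SameBox v a a
    same = (λ _ _ z → z) , (λ _ _ z → z)
    unique : ∀ {m} → m < 2 → (a b : Fin m) → a ≡ b
    unique m<2 a b = toℕ-injective (trans (n<1⇒n≡0 (<-≤-trans (toℕ<n a) (s≤s⁻¹ m<2)))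
                                               (sym (n<1⇒n≡0 (<-≤-trans (toℕ<n b) (s≤s⁻¹ m<2)))))

  whole-box-unique : ∀ {i} → SpanningCorner v i → (∀ k → Sub k i) → ¬ MoreThanOneBox v
  whole-box-unique span inside (a , b , span-a , span-b , a≠b) =
    a≠b (sub⇒box (Sub-trans (inside a) (maximal span-b (inside b))) ,
         sub⇒box (Sub-trans (inside b) (maximal span-a (inside a))))

  up-crossing : W0vNotInMaxParabolic v → AllCutsCrossed D
  up-crossing not-parabolic J 1≤J J<n with any? (λ k → pos k ≤? J ×-dec J <? w k)
  ... | yes found = found
  ... | no none = ⊥-elim (not-parabolic J 1≤J (<⇒≤∸1 J<n) parabolic)
    where
    parabolic : W0vInParabolic v J
    parabolic k pk≤J = ≮⇒≥ λ J<wk → none (k , pk≤J , J<wk)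

  -- Counting: if every point with w ≤ J lies in the first J rows, these J
  -- points fill those rows, so no point of the first J rows has w > J.
  crossing-balance : ∀ J → J ≤ n → ∀ k₀ → pos k₀ ≤ J → J < w k₀ →
                     ¬ (∀ k → w k ≤ J → pos k ≤ J)
  crossing-balance J J≤n k₀ pk₀≤J J<wk₀ closed = 1+n≰n (injection-below h h-injective h-below)
    where
    h : Fin (suc J) → Fin n
    h Fin.zero    = k₀
    h (Fin.suc a) = atAntiColumn (inject≤ a J≤n)
    w-h : ∀ a → w (h (Fin.suc a)) ≡ suc (toℕ a)
    w-h a = trans (w-atAntiColumn (inject≤ a J≤n)) (cong suc (toℕ-inject≤ a J≤n))
    w-h≤J : ∀ a → w (h (Fin.suc a)) ≤ J
    w-h≤J a = subst (_≤ J) (sym (w-h a)) (toℕ<n a)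
    h-below : ∀ a → toℕ (h a) < J
    h-below Fin.zero    = pk₀≤J
    h-below (Fin.suc a) = closed (h (Fin.suc a)) (w-h≤J a)
    k₀-new : ∀ a → k₀ ≢ h (Fin.suc a)
    k₀-new a e = <⇒≱ J<wk₀ (subst (λ k → w k ≤ J) (sym e) (w-h≤J a))
    h-injective : ∀ {a b} → h a ≡ h b → a ≡ b
    h-injective {Fin.zero}  {Fin.zero}  _ = refl
    h-injective {Fin.zero}  {Fin.suc b} e = ⊥-elim (k₀-new b e)
    h-injective {Fin.suc a} {Fin.zero}  e = ⊥-elim (k₀-new a (sym e))
    h-injective {Fin.suc a} {Fin.suc b} e =
      cong Fin.suc (toℕ-injective (suc-injective (trans (sym (w-h a)) (trans (cong w e) (w-h b)))))

  down-crossing : AllCutsCrossed D → AllCutsCrossed (transpose D)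
  down-crossing up J 1≤J J<n with any? (λ k → w k ≤? J ×-dec J <? pos k) | up J 1≤J J<n
  ... | yes found | _ = found
  ... | no none | k₀ , pk₀≤J , J<wk₀ =
    ⊥-elim (crossing-balance J (<⇒≤ J<n) k₀ pk₀≤J J<wk₀ λ k wk≤J → ≮⇒≥ λ J<pk → none (k , wk≤J , J<pk))

module BoundingBoxes {n : ℕ} (v : Permutation′ n)
                     (avoids : Avoids2143 v) (not-parabolic : W0vNotInMaxParabolic v) where
  open Corners v

  up : AllCutsCrossed D
  up = up-crossing not-parabolic

  down : AllCutsCrossed (transpose D)
  down = down-crossing up

  pattern-free : ¬ Pattern3412 D
  pattern-free = avoids ∘ 3412⇒2143

  -- No bounding box is green: a crossing of the cut at its corner (or just
  -- below it, for the corner (n , n)) would enlarge it strictly.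
  no-green : 2 ≤ n → ∀ {i} → SpanningCorner v i → pos i ≢ w i
  no-green two {i} span p≡w with pos i <? n
  ... | yes c<n with up (pos i) (s≤s z≤n) c<n
  ...   | k , pk≤c , c<wk = <⇒≱ hi<hk (maximal-hi span lk≤li)
    where
    lk≤li : lo k ≤ lo i
    lk≤li = ≤-trans (lo≤p k) (subst (pos k ≤_) (sym (green-lo p≡w)) pk≤c)
    hi<hk : hi i < hi k
    hi<hk = subst (_< hi k) (sym (green-hi p≡w)) (<-≤-trans c<wk (w≤hi k))
  no-green two {i} span p≡w | no c≮n with crossing-below D up n two ≤-refl
  ...   | k , pk<n , n≤wk = <⇒≱ lk<li (proj₁ (maximal span (<⇒≤ lk<li , hi≤hk)))
    where
    lk<li : lo k < lo i
    lk<li = ≤-<-trans (lo≤p k) (<-≤-trans pk<n (subst (n ≤_) (sym (green-lo p≡w)) (≮⇒≥ c≮n)))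
    hi≤hk : hi i ≤ hi k
    hi≤hk = ≤-trans (subst (_≤ n) (sym (green-hi p≡w)) (toℕ<n i)) (≤-trans n≤wk (w≤hi k))

  colour : 2 ≤ n → ∀ {i} → SpanningCorner v i → Blue v i ⊎ Red v i
  colour two {i} span with <-cmp (pos i) (w i)
  ... | tri< p<w _ _ = inj₁ (p<w⇒blue p<w)
  ... | tri≈ _ p≡w _ = ⊥-elim (no-green two span p≡w)
  ... | tri> _ _ w<p = inj₂ (w<p⇒red w<p)

  consecutive-hi : ∀ {i j} → Consecutive v i j → hi i < hi j
  consecutive-hi (_ , span-j , li<lj , _) = ≰⇒> λ hj≤hi → <⇒≱ li<lj (proj₁ (maximal span-j (<⇒≤ li<lj , hj≤hi)))

  consecutive-floor : ∀ {i j} → Consecutive v i j → ∀ k → lo k < lo j → hi k ≤ hi i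
  consecutive-floor {i} (span-i , _ , _ , nothing-between) k lk<lj with bounding-above k
  ... | m , span-m , (lm≤lk , hk≤hm) = ≤-trans hk≤hm (maximal-hi span-i lm≤li)
    where
    lm≤li : lo m ≤ lo i
    lm≤li = ≮⇒≥ λ li<lm → nothing-between (m , span-m , li<lm , ≤-<-trans lm≤lk lk<lj)

  no-red-pair : ∀ {i j} → Consecutive v i j → Red v i → Red v j → Pattern3412 D
  no-red-pair {i} {j} c@(_ , _ , li<lj , _) red-i red-j =
    red-staircase-3412 D up i j w<p-i w<p-j wi<wj pi<pj floor
    where
    w<p-i : w i < pos i
    w<p-i = red⇒w<p red-i
    w<p-j : w j < pos j
    w<p-j = red⇒w<p red-j
    wi<wj : w i < w j
    wi<wj = subst₂ _<_ (lo-above (<⇒≤ w<p-i)) (lo-above (<⇒≤ w<p-j)) li<lj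
    pi<pj : pos i < pos j
    pi<pj = subst₂ _<_ (hi-above (<⇒≤ w<p-i)) (hi-above (<⇒≤ w<p-j)) (consecutive-hi c)
    floor : ∀ k → pos k < w j → w k ≤ pos i
    floor k pk<wj = ≤-trans (w≤hi k) (subst (hi k ≤_) (hi-above (<⇒≤ w<p-i))
      (consecutive-floor c k (≤-<-trans (lo≤p k) (subst (pos k <_) (sym (lo-above (<⇒≤ w<p-j))) pk<wj))))

  no-blue-pair : ∀ {i j} → Consecutive v i j → Blue v i → Blue v j → Pattern3412 D
  no-blue-pair {i} {j} c@(_ , _ , li<lj , _) blue-i blue-j =
    transpose-3412 D (red-staircase-3412 (transpose D) down i j p<w-i p<w-j pi<pj wi<wj floor)
    where
    p<w-i : pos i < w i
    p<w-i = blue⇒p<w blue-i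
    p<w-j : pos j < w j
    p<w-j = blue⇒p<w blue-j
    pi<pj : pos i < pos j
    pi<pj = subst₂ _<_ (lo-below (<⇒≤ p<w-i)) (lo-below (<⇒≤ p<w-j)) li<lj
    wi<wj : w i < w j
    wi<wj = subst₂ _<_ (hi-below (<⇒≤ p<w-i)) (hi-below (<⇒≤ p<w-j)) (consecutive-hi c)
    floor : ∀ k → w k < pos j → pos k ≤ w i
    floor k wk<pj = ≤-trans (p≤hi k) (subst (hi k ≤_) (hi-below (<⇒≤ p<w-i))
      (consecutive-floor c k (≤-<-trans (lo≤w k) (subst (w k <_) (sym (lo-below (<⇒≤ p<w-j))) wk<pj))))

  alternation : 2 ≤ n → ∀ {i j} → Consecutive v i j → (Blue v i × Red v j) ⊎ (Red v i × Blue v j)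
  alternation two c@(span-i , span-j , _) with colour two span-i | colour two span-j
  ... | inj₁ blue-i | inj₁ blue-j = ⊥-elim (pattern-free (no-blue-pair c blue-i blue-j))
  ... | inj₁ blue-i | inj₂ red-j  = inj₁ (blue-i , red-j)
  ... | inj₂ red-i  | inj₁ blue-j = inj₂ (red-i , blue-j)
  ... | inj₂ red-i  | inj₂ red-j  = ⊥-elim (pattern-free (no-red-pair c red-i red-j))

  -- A purple box [L , H] (red corner i = (H , L), blue corner j = (L , H))
  -- is the whole square unless it yields a 3412 pattern; the whole square
  -- would be the only bounding box.
  no-purple : MoreThanOneBox v → ¬ PurpleBoxExists v
  no-purple more (i , j , span-i , _ , (i⊆j , j⊆i) , red , blue) = by-position (pos i <? n) (2 ≤? w i)
    where
    w<p-i : w i < pos i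
    w<p-i = red⇒w<p red
    p<w-j : pos j < w j
    p<w-j = blue⇒p<w blue
    lo-i : lo i ≡ w i
    lo-i = lo-above (<⇒≤ w<p-i)
    hi-i : hi i ≡ pos i
    hi-i = hi-above (<⇒≤ w<p-i)
    pj≡wi : pos j ≡ w i
    pj≡wi = trans (sym (lo-below (<⇒≤ p<w-j))) (trans (≤-antisym (proj₁ (box⇒sub i⊆j)) (proj₁ (box⇒sub j⊆i))) lo-i)
    wj≡pi : w j ≡ pos i
    wj≡pi = trans (sym (hi-below (<⇒≤ p<w-j))) (trans (≤-antisym (proj₂ (box⇒sub j⊆i)) (proj₂ (box⇒sub i⊆j))) hi-i)
    straddle-p : ∀ k → pos k < w i → w k ≤ pos i
    straddle-p k pk<L = ≤-trans (w≤hi k) (subst (hi k ≤_) hi-i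
      (maximal-hi span-i (≤-trans (lo≤p k) (subst (pos k ≤_) (sym lo-i) (<⇒≤ pk<L)))))
    straddle-w : ∀ k → w k < w i → pos k ≤ pos i
    straddle-w k wk<L = ≤-trans (p≤hi k) (subst (hi k ≤_) hi-i
      (maximal-hi span-i (≤-trans (lo≤w k) (subst (w k ≤_) (sym lo-i) (<⇒≤ wk<L)))))
    open PurpleBox D up down i j pj≡wi wj≡pi w<p-i straddle-p straddle-w
    inside : ¬ pos i < n → ¬ 2 ≤ w i → ∀ k → Sub k i
    inside H≮n 2≰L k = subst (_≤ lo k) (sym lo-i) (≤-trans (s≤s⁻¹ (≰⇒> 2≰L)) (lo≥1 k)) ,
               subst (hi k ≤_) (sym hi-i) (≤-trans (hi≤n k) (≮⇒≥ H≮n))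
    by-position : Dec (pos i < n) → Dec (2 ≤ w i) → ⊥
    by-position (yes H<n) _         = pattern-free (top-3412 H<n)
    by-position (no _)    (yes 2≤L) = pattern-free (bottom-3412 2≤L)
    by-position (no H≮n)  (no 2≰L)  = whole-box-unique span-i (inside H≮n 2≰L) more

proposition3p12 : (n : ℕ) (v : Permutation′ n) →
    Avoids2143 v → W0vNotInMaxParabolic v → MoreThanOneBox v →
      ((i : Fin n) → SpanningCorner v i → Blue v i ⊎ Red v i) ×
      ((i j : Fin n) → Consecutive v i j → (Blue v i × Red v j) ⊎ (Red v i × Blue v j)) ×
      ¬ PurpleBoxExists v
proposition3p12 n v avoids not-parabolic more =
  (λ _ → colour two) , (λ _ _ → alternation two) , no-purple more
  where
  open Corners v using (more⇒2≤n)
  open BoundingBoxes v avoids not-parabolic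
  two : 2 ≤ n
  two = more⇒2≤n more
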